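{- Let $\mathcal{P}$ be a natural unit interval order on $[1,n]$. The following two conditions are equivalent. (1) $\mathcal{P}$ avoids $\mathcal{P}_{(3,1,1),5}$. (2) Whenever $\mathcal{L}$ and $\mathcal{L}'$ are ladders in $\mathcal{P}$ with $\mathcal{L}\cap\mathcal{L}'=\{x\}$, $x$ is the maximum of $\mathcal{L}$ and the minimum of $\mathcal{L}'$ with respect to the usual order, and $|\mathcal{L}|,|\mathcal{L}'|\ge3$, the set $\mathcal{L}\cup\mathcal{L}'$ is also a ladder in $\mathcal{P}$.
   Context: A natural unit interval order on $[1,n]$ is a partial order $\prec$ with (i) $a\prec b\Rightarrow a<b$, and (ii) if $b\prec c$ and $a$ is incomparable to both $b,c$ then $b<a<c$. A ladder order is a partial order isomorphic to the order on $[1,m]$ in which $a\prec b$ iff $a\le b-2$; a subset $A$ is a ladder in $\mathcal{P}$ if the restriction of $\mathcal{P}$ to $A$ is a ladder order. $\mathcal{P}_{(3,1,1),5}$ is the order on $\{1,\dots,5\}$ whose strict relations are exactly $1\prec3,1\prec4,1\prec5,2\prec5,3\prec5$; $\mathcal{P}$ avoids it if no restriction of $\mathcal{P}$ to a 5-element subset is isomorphic to it. -}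

module Defs where

open import Data.Nat using (ℕ; _+_; _≤_)
open import Data.Fin using (Fin; toℕ; zero; suc; _<_) renaming (_≤_ to _≤ᶠ_)
open import Data.Fin.Subset using (Subset; _∈_; _∩_; _∪_; ⁅_⁆; ∣_∣)
open import Data.Product using (Σ; ∃; _×_)
open import Relation.Binary.PropositionalEquality using (_≡_; _≢_)
open import Relation.Nullary using (¬_; Dec)
open import Function.Definitions using (Injective)
open import Function.Bundles using (_⇔_)

-- A finite (strict) partial order on [1,n], represented on Fin n
-- (element i of Fin n stands for i+1), together with the two
-- axioms of a natural unit interval order.
record NUIO (n : ℕ) : Set₁ where
  field
    _≺_      : Fin n → Fin n → Set
    ≺-dec    : ∀ a b → Dec (a ≺ b)
    ≺-irrefl : ∀ a → ¬ (a ≺ a)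
    ≺-trans  : ∀ {a b c} → a ≺ b → b ≺ c → a ≺ c
    natural  : ∀ {a b} → a ≺ b → a < b
    unitInt  : ∀ {a b c} → b ≺ c →
               (a ≢ b × ¬ (a ≺ b) × ¬ (b ≺ a)) →
               (a ≢ c × ¬ (a ≺ c) × ¬ (c ≺ a)) →
               (b < a × a < c)

open NUIO public

LadderRel : (m : ℕ) → Fin m → Fin m → Set
LadderRel m i j = toℕ i + 2 ≤ toℕ j

IsLadder : ∀ {n} → NUIO n → Subset n → Set
IsLadder {n} P A =
  Σ ℕ λ m → Σ (Fin m → Fin n) λ f →
    Injective _≡_ _≡_ f ×
    (∀ i → f i ∈ A) ×
    (∀ x → x ∈ A → ∃ λ i → f i ≡ x) ×
    (∀ i j → (_≺_ P (f i) (f j)) ⇔ LadderRel m i j)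

-- The order P_{(3,1,1),5} on {1,..,5} (shifted to Fin 5: k ↦ k-1):
-- strict relations 1≺3, 1≺4, 1≺5, 2≺5, 3≺5.
data P311 : Fin 5 → Fin 5 → Set where
  r13 : P311 zero (suc (suc zero))
  r14 : P311 zero (suc (suc (suc zero)))
  r15 : P311 zero (suc (suc (suc (suc zero))))
  r25 : P311 (suc zero) (suc (suc (suc (suc zero))))
  r35 : P311 (suc (suc zero)) (suc (suc (suc (suc zero))))

ContainsP311 : ∀ {n} → NUIO n → Set
ContainsP311 {n} P =
  Σ (Fin 5 → Fin n) λ g → Injective _≡_ _≡_ g ×
    (∀ i j → (_≺_ P (g i) (g j)) ⇔ P311 i j)

AvoidsP311 : ∀ {n} → NUIO n → Set
AvoidsP311 P = ¬ ContainsP311 P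

IsMax : ∀ {n} → Fin n → Subset n → Set
IsMax x A = x ∈ A × (∀ y → y ∈ A → y ≤ᶠ x)

IsMin : ∀ {n} → Fin n → Subset n → Set
IsMin x A = x ∈ A × (∀ y → y ∈ A → x ≤ᶠ y)

LadderGluing : ∀ {n} → NUIO n → Set
LadderGluing {n} P =
  ∀ (L L' : Subset n) (x : Fin n) →
    IsLadder P L → IsLadder P L' →
    L ∩ L' ≡ ⁅ x ⁆ →
    IsMax x L → IsMin x L' →
    3 ≤ ∣ L ∣ → 3 ≤ ∣ L' ∣ →
    IsLadder P (L ∪ L')

module Submission where

-- In a natural unit interval order, ≺ is compatible with the natural order: x < y ≺ z and
-- x ≺ y < z both give x ≺ z (apply axiom (ii) to the pair that would otherwise be
-- incomparable). Hence an ascending sequence is a ladder as soon as consecutive terms are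
-- incomparable and terms two apart are related, and conversely every ladder with at least
-- three elements, listed in ladder order, is ascending. Gluing two such ladders at
-- x = max L = min L′ therefore yields a ladder exactly when the predecessor of x in L is
-- below the successor of x in L′; if it is not, the two predecessors of x, x itself and its
-- two successors form a copy of P₍₃,₁,₁₎,₅. Conversely, a copy e₀, …, e₄ of P₍₃,₁,₁₎,₅
-- splits into the ladders {e₀, e₁, e₂} and {e₂, e₃, e₄}, whose union is no ladder: e₁ is
-- incomparable to e₀, e₂ and e₃, while in a ladder each element is incomparable only to
-- its two neighbours.

open import Defs hiding (_≺_; ≺-dec; ≺-irrefl; ≺-trans; natural; unitInt)
open import Data.Nat
  using (ℕ; zero; suc; _+_; _≤_; _<_; _≤?_; _<?_; z≤n; s≤s; z<s; s≤s⁻¹)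
open import Data.Nat.Properties
open import Data.Fin using (Fin; toℕ; fromℕ<)
  renaming (zero to fzero; suc to fsuc; _<_ to _<ᶠ_; _≤_ to _≤ᶠ_)
import Data.Fin.Properties as Fin
open import Data.Fin.Patterns using (0F; 1F; 2F; 3F; 4F)
open import Data.Fin.Subset
  using (Subset; inside; outside; _∈_; _∉_; _⊆_; _∩_; _∪_; ⁅_⁆; ∣_∣; ⊥)
open import Data.Fin.Subset.Properties
open import Data.Product using (Σ; ∃; _×_; _,_; proj₁; proj₂)
open import Data.Sum using (_⊎_; inj₁; inj₂)
open import Data.Vec using ([]; _∷_)
open import Data.Empty renaming (⊥ to Empty)
open import Relation.Binary.PropositionalEquality
open import Relation.Binary.Definitions using (tri<; tri≈; tri>)
open import Relation.Nullary using (¬_; yes; no; contradiction)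
open import Relation.Nullary.Decidable using (True; toWitness)
open import Function.Base using (_∘_)
open import Function.Bundles using (_⇔_; mk⇔; Equivalence)
open import Algebra.Properties.CommutativeSemigroup +-commutativeSemigroup using (x∙yz≈y∙xz)

private
  variable
    n m a q d k l : ℕ

∣p∪q∣≤∣p∣+∣q∣ : (p q : Subset n) → ∣ p ∪ q ∣ ≤ ∣ p ∣ + ∣ q ∣
∣p∪q∣≤∣p∣+∣q∣ []            []            = z≤n
∣p∪q∣≤∣p∣+∣q∣ (inside  ∷ p) (inside  ∷ q) =
  s≤s (≤-trans (∣p∪q∣≤∣p∣+∣q∣ p q) (+-monoʳ-≤ ∣ p ∣ (n≤1+n _)))
∣p∪q∣≤∣p∣+∣q∣ (inside  ∷ p) (outside ∷ q) = s≤s (∣p∪q∣≤∣p∣+∣q∣ p q)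
∣p∪q∣≤∣p∣+∣q∣ (outside ∷ p) (inside  ∷ q) =
  ≤-trans (s≤s (∣p∪q∣≤∣p∣+∣q∣ p q)) (≤-reflexive (sym (+-suc ∣ p ∣ ∣ q ∣)))
∣p∪q∣≤∣p∣+∣q∣ (outside ∷ p) (outside ∷ q) = ∣p∪q∣≤∣p∣+∣q∣ p q

clamp : ℕ → Fin (suc m)
clamp {zero}  _       = fzero
clamp {suc m} zero    = fzero
clamp {suc m} (suc k) = fsuc (clamp k)

toℕ-clamp : k ≤ m → toℕ (clamp {m} k) ≡ k
toℕ-clamp {zero}  {zero}  z≤n       = refl
toℕ-clamp {zero}  {suc m} z≤n       = refl
toℕ-clamp {suc k} {suc m} (s≤s k≤m) = cong suc (toℕ-clamp k≤m)

clamp-toℕ : (i : Fin (suc m)) → clamp (toℕ i) ≡ i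
clamp-toℕ {zero}  fzero    = refl
clamp-toℕ {suc m} fzero    = refl
clamp-toℕ {suc m} (fsuc i) = cong fsuc (clamp-toℕ i)

module _ {n : ℕ} where

  image : (ℕ → Fin n) → ℕ → Subset n
  image s zero    = ⊥
  image s (suc m) = image s m ∪ ⁅ s m ⁆

  ∈-image⁺ : ∀ {s} → k < m → s k ∈ image s m
  ∈-image⁺ {k} {suc m} {s} k<1+m with m≤n⇒m<n∨m≡n (s≤s⁻¹ k<1+m)
  ... | inj₁ k<m  = x∈p∪q⁺ (inj₁ (∈-image⁺ k<m))
  ... | inj₂ refl = x∈p∪q⁺ (inj₂ (x∈⁅x⁆ (s k)))

  ∈-image⁻ : ∀ {s y} → y ∈ image s m → ∃ λ k → k < m × s k ≡ y
  ∈-image⁻ {zero}  y∈ = contradiction y∈ ∉⊥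
  ∈-image⁻ {suc m} {s} y∈ with x∈p∪q⁻ (image s m) ⁅ s m ⁆ y∈
  ... | inj₁ y∈′ = let k , k<m , eq = ∈-image⁻ y∈′ in k , m<n⇒m<1+n k<m , eq
  ... | inj₂ y∈⁅⁆ = m , ≤-refl , sym (x∈⁅y⁆⇒x≡y (s m) y∈⁅⁆)

  ∣image∣≤ : ∀ s m → ∣ image s m ∣ ≤ m
  ∣image∣≤ s zero    = ≤-reflexive (∣⊥∣≡0 n)
  ∣image∣≤ s (suc m) = begin
    ∣ image s m ∪ ⁅ s m ⁆ ∣  ≤⟨ ∣p∪q∣≤∣p∣+∣q∣ (image s m) ⁅ s m ⁆ ⟩
    ∣ image s m ∣ + ∣ ⁅ s m ⁆ ∣ ≡⟨ cong (∣ image s m ∣ +_) (∣⁅x⁆∣≡1 (s m)) ⟩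
    ∣ image s m ∣ + 1        ≤⟨ +-monoˡ-≤ 1 (∣image∣≤ s m) ⟩
    m + 1                    ≡⟨ +-comm m 1 ⟩
    suc m                    ∎
    where open ≤-Reasoning

  image-injective⇒≤∣image∣ : ∀ {s} → (∀ {k l} → k < m → l < m → s k ≡ s l → k ≡ l) →
    m ≤ ∣ image s m ∣
  image-injective⇒≤∣image∣ {zero}          _   = z≤n
  image-injective⇒≤∣image∣ {suc m} {s} inj =
    ≤-<-trans (image-injective⇒≤∣image∣ (λ k<m l<m → inj (m<n⇒m<1+n k<m) (m<n⇒m<1+n l<m)))
              (p⊂q⇒∣p∣<∣q∣ (p⊆p∪q ⁅ s m ⁆ , s m , x∈p∪q⁺ (inj₂ (x∈⁅x⁆ (s m))) , sm∉))
    where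
    sm∉ : s m ∉ image s m
    sm∉ sm∈ = let k , k<m , eq = ∈-image⁻ sm∈ in <-irrefl (inj (m<n⇒m<1+n k<m) ≤-refl eq) k<m

Window : ∀ {ℓ} {X : Set} → ℕ → ℕ → (X → X → Set ℓ) → (ℕ → X) → Set ℓ
Window d m R s = ∀ k → d + k < m → R (s k) (s (d + k))

module _ {n : ℕ} where

  Ascending : ℕ → (ℕ → Fin n) → Set
  Ascending m s = Window 1 m _<ᶠ_ s

  module _ {m : ℕ} {s : ℕ → Fin n} (asc : Ascending m s) where

    ascending⇒< : k < l → l < m → s k <ᶠ s l
    ascending⇒< {k} {suc l} k<1+l 1+l<m with m≤n⇒m<n∨m≡n (s≤s⁻¹ k<1+l)
    ... | inj₁ k<l  = <-trans (ascending⇒< k<l (<⇒≤ 1+l<m)) (asc l 1+l<m)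
    ... | inj₂ refl = asc k 1+l<m

    ascending⇒≤ : k ≤ l → l < m → s k ≤ᶠ s l
    ascending⇒≤ k≤l l<m with m≤n⇒m<n∨m≡n k≤l
    ... | inj₁ k<l  = <⇒≤ (ascending⇒< k<l l<m)
    ... | inj₂ refl = ≤-refl

    ascending-reflects-< : k < m → s k <ᶠ s l → k < l
    ascending-reflects-< {k} {l} k<m sk<sl with k <? l
    ... | yes k<l = k<l
    ... | no k≮l  = contradiction (ascending⇒≤ (≮⇒≥ k≮l) k<m) (<⇒≱ sk<sl)

    ascending-injective : k < m → l < m → s k ≡ s l → k ≡ l
    ascending-injective {k} {l} k<m l<m eq with <-cmp k l
    ... | tri< k<l _ _ = contradiction (cong toℕ eq) (<⇒≢ (ascending⇒< k<l l<m))
    ... | tri≈ _ k≡l _ = k≡l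
    ... | tri> _ _ l<k = contradiction (cong toℕ (sym eq)) (<⇒≢ (ascending⇒< l<k k<m))

    ascending⇒≤∣image∣ : m ≤ ∣ image s m ∣
    ascending⇒≤∣image∣ = image-injective⇒≤∣image∣ ascending-injective

  ascending⇒isMax : ∀ {s} → Ascending (suc a) s → IsMax (s a) (image s (suc a))
  ascending⇒isMax {a} {s} asc = ∈-image⁺ {k = a} ≤-refl , λ y y∈ →
    let k , k<1+a , eq = ∈-image⁻ y∈ in subst (_≤ᶠ s a) eq (ascending⇒≤ asc (s≤s⁻¹ k<1+a) ≤-refl)

  ascending⇒isMin : ∀ {s} → Ascending m s → 0 < m → IsMin (s 0) (image s m)
  ascending⇒isMin {s = s} asc 0<m = ∈-image⁺ {k = 0} 0<m , λ y y∈ →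
    let k , k<m , eq = ∈-image⁻ y∈ in subst (s 0 ≤ᶠ_) eq (ascending⇒≤ asc z≤n k<m)

  isMax-unique : ∀ {x y A} → IsMax {n} x A → IsMax y A → x ≡ y
  isMax-unique (x∈ , ≤x) (y∈ , ≤y) = Fin.≤-antisym (≤y _ x∈) (≤x _ y∈)

  isMin-unique : ∀ {x y A} → IsMin {n} x A → IsMin y A → x ≡ y
  isMin-unique (x∈ , x≤) (y∈ , y≤) = Fin.≤-antisym (x≤ _ y∈) (y≤ _ x∈)

  isMax∧isMin⇒∩≡⁅⁆ : ∀ {x A B} → IsMax {n} x A → IsMin x B → A ∩ B ≡ ⁅ x ⁆
  isMax∧isMin⇒∩≡⁅⁆ {x} {A} {B} (x∈A , ≤x) (x∈B , x≤) = ⊆-antisym ∩⊆⁅x⁆ ⁅x⁆⊆∩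
    where
    ∩⊆⁅x⁆ : A ∩ B ⊆ ⁅ x ⁆
    ∩⊆⁅x⁆ y∈ with x∈p∩q⁻ A B y∈
    ... | y∈A , y∈B = subst (_∈ ⁅ x ⁆) (Fin.≤-antisym (x≤ _ y∈B) (≤x _ y∈A)) (x∈⁅x⁆ x)
    ⁅x⁆⊆∩ : ⁅ x ⁆ ⊆ A ∩ B
    ⁅x⁆⊆∩ y∈ rewrite x∈⁅y⁆⇒x≡y x y∈ = x∈p∩q⁺ (x∈A , x∈B)

module _ {X : Set} where

  -- glue a s t is s 0, …, s (a - 1) followed by t; it joins s and t at s a = t 0.
  glue : ℕ → (ℕ → X) → (ℕ → X) → ℕ → X
  glue zero    s t         = t
  glue (suc a) s t zero    = s zero
  glue (suc a) s t (suc k) = glue a (λ i → s (suc i)) t k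

  glue-≤ : ∀ {s t} → s a ≡ t 0 → k ≤ a → glue a s t k ≡ s k
  glue-≤ {zero}  sa≡t0 z≤n       = sym sa≡t0
  glue-≤ {suc a} sa≡t0 z≤n       = refl
  glue-≤ {suc a} {s = s} sa≡t0 (s≤s k≤a) = glue-≤ {s = λ i → s (suc i)} sa≡t0 k≤a

  glue-+ : ∀ {s t} a j → glue a s t (a + j) ≡ t j
  glue-+ zero    j = refl
  glue-+ {s} (suc a) j = glue-+ {s = λ i → s (suc i)} a j

  glue-window : ∀ {ℓ} {R : X → X → Set ℓ} {s t} →
    Window d (suc a) R s → Window d q R t → s a ≡ t 0 →
    (∀ k j → k < a → d + k ≡ suc (a + j) → R (s k) (t (suc j))) →
    Window d (a + q) R (glue a s t)
  glue-window {d} {a} {q} {R = R} {s} {t} Ws Wt sa≡t0 across k d+k<a+q with d + k ≤? a | a ≤? k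
  ... | yes d+k≤a | _ =
    subst₂ R (sym (glue-≤ sa≡t0 (≤-trans (m≤n+m k d) d+k≤a))) (sym (glue-≤ sa≡t0 d+k≤a))
      (Ws k (s≤s d+k≤a))
  ... | no _ | yes a≤k with m≤n⇒∃[o]m+o≡n a≤k
  ...   | j , refl =
    subst₂ R (sym (glue-+ a j)) (sym (trans (cong (glue a s t) d+[a+j]≡a+[d+j]) (glue-+ a (d + j))))
      (Wt j (+-cancelˡ-< a (d + j) q (subst (_< a + q) d+[a+j]≡a+[d+j] d+k<a+q)))
    where
    d+[a+j]≡a+[d+j] : d + (a + j) ≡ a + (d + j)
    d+[a+j]≡a+[d+j] = x∙yz≈y∙xz d a j
  glue-window {d} {a} {q} {R = R} {s} {t} Ws Wt sa≡t0 across k d+k<a+q | no d+k≰a | no a≰k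
    with m≤n⇒∃[o]m+o≡n (≰⇒> d+k≰a)
  ... | j , 1+a+j≡d+k =
    subst₂ R (sym (glue-≤ sa≡t0 (<⇒≤ k<a)))
      (sym (trans (cong (glue a s t) (trans (sym 1+a+j≡d+k) (sym (+-suc a j)))) (glue-+ a (suc j))))
      (across k j k<a (sym 1+a+j≡d+k))
    where
    k<a : k < a
    k<a = ≰⇒> a≰k

image-glue : ∀ {n} {s t : ℕ → Fin n} → s a ≡ t 0 →
  image (glue a s t) (a + suc q) ≡ image s (suc a) ∪ image t (suc q)
image-glue {a} {q} {n} {s} {t} sa≡t0 = ⊆-antisym ⊆-∪ ∪-⊆
  where
  u : ℕ → Fin n
  u = glue a s t
  ⊆-∪ : image u (a + suc q) ⊆ image s (suc a) ∪ image t (suc q)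
  ⊆-∪ y∈ with ∈-image⁻ {s = u} y∈
  ... | k , k<a+1+q , refl with k ≤? a
  ...   | yes k≤a = subst (_∈ _) (sym (glue-≤ sa≡t0 k≤a)) (x∈p∪q⁺ (inj₁ (∈-image⁺ (s≤s k≤a))))
  ...   | no k≰a with m≤n⇒∃[o]m+o≡n (<⇒≤ (≰⇒> k≰a))
  ...     | j , refl = subst (_∈ _) (sym (glue-+ a j))
                         (x∈p∪q⁺ (inj₂ (∈-image⁺ (+-cancelˡ-< a j (suc q) k<a+1+q))))
  ∪-⊆ : image s (suc a) ∪ image t (suc q) ⊆ image u (a + suc q)
  ∪-⊆ y∈ with x∈p∪q⁻ (image s (suc a)) (image t (suc q)) y∈
  ... | inj₁ y∈s with ∈-image⁻ {s = s} y∈s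
  ...   | k , k<1+a , refl = subst (_∈ image u (a + suc q)) (glue-≤ {s = s} sa≡t0 k≤a)
                               (∈-image⁺ {s = u} (≤-<-trans k≤a (m<m+n a z<s)))
    where k≤a = s≤s⁻¹ k<1+a
  ∪-⊆ y∈ | inj₂ y∈t with ∈-image⁻ {s = t} y∈t
  ...   | j , j<1+q , refl =
    subst (_∈ image u (a + suc q)) (glue-+ {s = s} a j) (∈-image⁺ {s = u} (+-monoʳ-< a j<1+q))

Adjacent : ℕ → ℕ → Set
Adjacent k l = l ≡ suc k ⊎ k ≡ suc l

k+2≰l⇒adjacent : k ≢ l → ¬ k + 2 ≤ l → ¬ l + 2 ≤ k → Adjacent k l
k+2≰l⇒adjacent {k} {l} k≢l k+2≰l l+2≰k with <-cmp k l
... | tri≈ _ k≡l _ = contradiction k≡l k≢l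
... | tri< k<l _ _ with m≤n⇒m<n∨m≡n k<l
...   | inj₁ 1+k<l = contradiction (subst (_≤ l) (+-comm 2 k) 1+k<l) k+2≰l
...   | inj₂ 1+k≡l = inj₁ (sym 1+k≡l)
k+2≰l⇒adjacent {k} {l} k≢l k+2≰l l+2≰k | tri> _ _ l<k with m≤n⇒m<n∨m≡n l<k
...   | inj₁ 1+l<k = contradiction (subst (_≤ k) (+-comm 2 l) 1+l<k) l+2≰k
...   | inj₂ 1+l≡k = inj₂ (sym 1+l≡k)

adjacent-pigeonhole : ∀ {t l₁ l₂ l₃} → Adjacent t l₁ → Adjacent t l₂ → Adjacent t l₃ →
  l₁ ≢ l₂ → l₁ ≢ l₃ → l₂ ≢ l₃ → Empty
adjacent-pigeonhole (inj₁ p) (inj₁ q) _        l₁≢l₂ _     _     = l₁≢l₂ (trans p (sym q))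
adjacent-pigeonhole (inj₂ p) (inj₂ q) _        l₁≢l₂ _     _     = l₁≢l₂ (suc-injective (trans (sym p) q))
adjacent-pigeonhole (inj₁ p) _        (inj₁ r) _     l₁≢l₃ _     = l₁≢l₃ (trans p (sym r))
adjacent-pigeonhole (inj₂ p) _        (inj₂ r) _     l₁≢l₃ _     = l₁≢l₃ (suc-injective (trans (sym p) r))
adjacent-pigeonhole _        (inj₁ q) (inj₁ r) _     _     l₂≢l₃ = l₂≢l₃ (trans q (sym r))
adjacent-pigeonhole _        (inj₂ q) (inj₂ r) _     _     l₂≢l₃ = l₂≢l₃ (suc-injective (trans (sym q) r))

module _ {n : ℕ} (P : NUIO n) where

  open NUIO P

  _∥_ : Fin n → Fin n → Set
  x ∥ y = x ≢ y × ¬ x ≺ y × ¬ y ≺ x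

  <⇒⊁ : ∀ {x y} → x <ᶠ y → ¬ y ≺ x
  <⇒⊁ x<y y≺x = <-asym x<y (natural y≺x)

  between : ∀ {x y z} → x ≺ z → ¬ x ≺ y → ¬ y ≺ z → x <ᶠ y × y <ᶠ z
  between {x} {y} {z} x≺z x⊀y y⊀z = unitInt {y} {x} {z} x≺z y∥x y∥z
    where
    y∥x : y ∥ x
    y∥x = (λ { refl → y⊀z x≺z }) , (λ y≺x → y⊀z (≺-trans y≺x x≺z)) , x⊀y
    y∥z : y ∥ z
    y∥z = (λ { refl → x⊀y x≺z }) , y⊀z , (λ z≺y → x⊀y (≺-trans x≺z z≺y))

  ≺-<-trans : ∀ {x y z} → x ≺ y → y <ᶠ z → x ≺ z
  ≺-<-trans {x} {y} {z} x≺y y<z with ≺-dec x z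
  ... | yes x≺z = x≺z
  ... | no x⊀z  = contradiction (proj₂ (between x≺y x⊀z (<⇒⊁ y<z))) (<-asym y<z)

  <-≺-trans : ∀ {x y z} → x <ᶠ y → y ≺ z → x ≺ z
  <-≺-trans {x} {y} {z} x<y y≺z with ≺-dec x z
  ... | yes x≺z = x≺z
  ... | no x⊀z  = contradiction (proj₁ (between y≺z (<⇒⊁ x<y) x⊀z)) (<-asym x<y)

  IsLadderSeq : ℕ → (ℕ → Fin n) → Set
  IsLadderSeq m s = ∀ {k l} → k < m → l < m → (s k ≺ s l ⇔ k + 2 ≤ l)

  record IsLocalLadder (m : ℕ) (s : ℕ → Fin n) : Set where
    field
      step-⊀ : Window 1 m (λ x y → ¬ x ≺ y) s
      skip-≺ : Window 2 m _≺_ s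

  open IsLocalLadder

  ladderSeq⇒localLadder : ∀ {s} → IsLadderSeq m s → IsLocalLadder m s
  ladderSeq⇒localLadder Ls = record
    { step-⊀ = λ k 1+k<m s≺ → k+2≰1+k (Equivalence.to (Ls (<⇒≤ 1+k<m) 1+k<m) s≺)
    ; skip-≺ = λ k 2+k<m → Equivalence.from (Ls (<⇒≤ (<⇒≤ 2+k<m)) 2+k<m) (≤-reflexive (+-comm k 2))
    }
    where
    k+2≰1+k : ∀ {k} → ¬ k + 2 ≤ suc k
    k+2≰1+k {k} k+2≤1+k = 1+n≰n (subst (_≤ suc k) (+-comm k 2) k+2≤1+k)

  module _ {m : ℕ} {s : ℕ → Fin n} (3≤m : 3 ≤ m) (L : IsLocalLadder m s) where

    -- Every consecutive pair is part of a window s j, s (1 + j), s (2 + j) ordered by between.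
    localLadder⇒ascending : Ascending m s
    localLadder⇒ascending zero    _      =
      proj₁ (between (skip-≺ L 0 3≤m) (step-⊀ L 0 (<⇒≤ 3≤m)) (step-⊀ L 1 3≤m))
    localLadder⇒ascending (suc j) 2+j<m =
      proj₂ (between (skip-≺ L j 2+j<m) (step-⊀ L j (<⇒≤ 2+j<m)) (step-⊀ L (suc j) 2+j<m))

    localLadder⇒ladderSeq : IsLadderSeq m s
    localLadder⇒ladderSeq {k} {l} k<m l<m = mk⇔ to from
      where
      asc : Ascending m s
      asc = localLadder⇒ascending
      to : s k ≺ s l → k + 2 ≤ l
      to sk≺sl with m≤n⇒m<n∨m≡n (ascending-reflects-< asc k<m (natural sk≺sl))
      ... | inj₁ 1+k<l = subst (_≤ l) (+-comm 2 k) 1+k<l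
      ... | inj₂ refl  = contradiction sk≺sl (step-⊀ L k l<m)
      from : k + 2 ≤ l → s k ≺ s l
      from k+2≤l with m≤n⇒m<n∨m≡n (subst (_≤ l) (+-comm k 2) k+2≤l)
      ... | inj₁ 2+k<l = ≺-<-trans (skip-≺ L k (<-trans 2+k<l l<m)) (ascending⇒< asc 2+k<l l<m)
      ... | inj₂ refl  = skip-≺ L k l<m

    localLadder⇒isLadder : IsLadder P (image s m)
    localLadder⇒isLadder =
      m , (λ i → s (toℕ i)) ,
      (λ e → Fin.toℕ-injective (ascending-injective asc (Fin.toℕ<n _) (Fin.toℕ<n _) e)) ,
      (λ i → ∈-image⁺ (Fin.toℕ<n i)) ,
      (λ y y∈ → let k , k<m , eq = ∈-image⁻ y∈ in
                fromℕ< k<m , trans (cong s (Fin.toℕ-fromℕ< k<m)) eq) ,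
      (λ i j → localLadder⇒ladderSeq (Fin.toℕ<n i) (Fin.toℕ<n j))
      where
      asc : Ascending m s
      asc = localLadder⇒ascending

  -- x ∈ A excludes the empty enumeration, which gives no value to extend to all of ℕ.
  isLadder⇒ladderSeq : ∀ {A x} → IsLadder P A → x ∈ A →
    Σ ℕ λ m → Σ (ℕ → Fin n) λ s → A ≡ image s m × IsLadderSeq m s
  isLadder⇒ladderSeq (zero , _ , _ , _ , onto , _) x∈A with onto _ x∈A
  ... | () , _
  isLadder⇒ladderSeq {A} (suc m , f , _ , f∈A , onto , f-rel) _ =
    suc m , s , ⊆-antisym A⊆ ⊆A , Ls
    where
    s : ℕ → Fin n
    s k = f (clamp k)
    A⊆ : A ⊆ image s (suc m)
    A⊆ y∈A with onto _ y∈A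
    ... | i , refl = subst (_∈ image s (suc m)) (cong f (clamp-toℕ i)) (∈-image⁺ (Fin.toℕ<n i))
    ⊆A : image s (suc m) ⊆ A
    ⊆A y∈ with ∈-image⁻ {m = suc m} {s = s} y∈
    ... | k , _ , refl = f∈A (clamp k)
    Ls : IsLadderSeq (suc m) s
    Ls {k} {l} k<1+m l<1+m =
      subst₂ (λ i j → s k ≺ s l ⇔ i + 2 ≤ j)
        (toℕ-clamp (s≤s⁻¹ k<1+m)) (toℕ-clamp (s≤s⁻¹ l<1+m)) (f-rel (clamp k) (clamp l))

  containsP311 : ∀ {e₀ e₁ e₂ e₃ e₄} → e₀ ≺ e₂ → e₂ ≺ e₄ →
    ¬ e₀ ≺ e₁ → ¬ e₁ ≺ e₂ → ¬ e₂ ≺ e₃ → ¬ e₃ ≺ e₄ → ¬ e₁ ≺ e₃ → ContainsP311 P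
  containsP311 {e₀} {e₁} {e₂} {e₃} {e₄} e₀≺e₂ e₂≺e₄ e₀⊀e₁ e₁⊀e₂ e₂⊀e₃ e₃⊀e₄ e₁⊀e₃ =
    g , g-injective , g-iso
    where
    w : ℕ → Fin n
    w 0 = e₀
    w 1 = e₁
    w 2 = e₂
    w 3 = e₃
    w _ = e₄
    asc : Ascending 5 w
    asc 0 _ = proj₁ (between e₀≺e₂ e₀⊀e₁ e₁⊀e₂)
    asc 1 _ = proj₂ (between e₀≺e₂ e₀⊀e₁ e₁⊀e₂)
    asc 2 _ = proj₁ (between e₂≺e₄ e₂⊀e₃ e₃⊀e₄)
    asc 3 _ = proj₂ (between e₂≺e₄ e₂⊀e₃ e₃⊀e₄)
    asc (suc (suc (suc (suc _)))) (s≤s (s≤s (s≤s (s≤s (s≤s ())))))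
    g : Fin 5 → Fin n
    g i = w (toℕ i)
    g-injective : ∀ {i j} → g i ≡ g j → i ≡ j
    g-injective e = Fin.toℕ-injective (ascending-injective asc (Fin.toℕ<n _) (Fin.toℕ<n _) e)
    downward : ∀ k l {_ : True (l ≤? k)} {_ : True (k <? 5)} → ¬ w k ≺ w l
    downward k l {l≤k} {k<5} wk≺wl =
      <⇒≱ (ascending-reflects-< asc (toWitness k<5) (natural wk≺wl)) (toWitness l≤k)
    related : ∀ {i j} → g i ≺ g j → P311 i j → (g i ≺ g j ⇔ P311 i j)
    related r c = mk⇔ (λ _ → c) (λ _ → r)
    unrelated : ∀ {i j} → ¬ g i ≺ g j → ¬ P311 i j → (g i ≺ g j ⇔ P311 i j)
    unrelated ¬r ¬c = mk⇔ (λ r → contradiction r ¬r) (λ c → contradiction c ¬c)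
    e₀≺e₃ : e₀ ≺ e₃
    e₀≺e₃ = ≺-<-trans e₀≺e₂ (asc 2 (s≤s (s≤s (s≤s (s≤s z≤n)))))
    e₀≺e₄ : e₀ ≺ e₄
    e₀≺e₄ = ≺-trans e₀≺e₂ e₂≺e₄
    e₁≺e₄ : e₁ ≺ e₄
    e₁≺e₄ = <-≺-trans (asc 1 (s≤s (s≤s (s≤s z≤n)))) e₂≺e₄
    g-iso : ∀ i j → (g i ≺ g j ⇔ P311 i j)
    g-iso 0F 0F = unrelated (downward 0 0) λ ()
    g-iso 0F 1F = unrelated e₀⊀e₁ λ ()
    g-iso 0F 2F = related e₀≺e₂ r13
    g-iso 0F 3F = related e₀≺e₃ r14
    g-iso 0F 4F = related e₀≺e₄ r15
    g-iso 1F 0F = unrelated (downward 1 0) λ ()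
    g-iso 1F 1F = unrelated (downward 1 1) λ ()
    g-iso 1F 2F = unrelated e₁⊀e₂ λ ()
    g-iso 1F 3F = unrelated e₁⊀e₃ λ ()
    g-iso 1F 4F = related e₁≺e₄ r25
    g-iso 2F 0F = unrelated (downward 2 0) λ ()
    g-iso 2F 1F = unrelated (downward 2 1) λ ()
    g-iso 2F 2F = unrelated (downward 2 2) λ ()
    g-iso 2F 3F = unrelated e₂⊀e₃ λ ()
    g-iso 2F 4F = related e₂≺e₄ r35
    g-iso 3F 0F = unrelated (downward 3 0) λ ()
    g-iso 3F 1F = unrelated (downward 3 1) λ ()
    g-iso 3F 2F = unrelated (downward 3 2) λ ()
    g-iso 3F 3F = unrelated (downward 3 3) λ ()
    g-iso 3F 4F = unrelated e₃⊀e₄ λ ()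
    g-iso 4F 0F = unrelated (downward 4 0) λ ()
    g-iso 4F 1F = unrelated (downward 4 1) λ ()
    g-iso 4F 2F = unrelated (downward 4 2) λ ()
    g-iso 4F 3F = unrelated (downward 4 3) λ ()
    g-iso 4F 4F = unrelated (downward 4 4) λ ()

  junction-≺ : ∀ {s t} → AvoidsP311 P → IsLocalLadder (3 + a) s → IsLocalLadder (3 + q) t →
    s (2 + a) ≡ t 0 → s (1 + a) ≺ t 1
  junction-≺ {a} {q} {s} {t} avoid Ls Lt s-end≡t₀ with ≺-dec (s (1 + a)) (t 1)
  ... | yes r = r
  ... | no ¬r = contradiction
    (containsP311 (subst (s a ≺_) s-end≡t₀ (skip-≺ Ls a ≤-refl)) (skip-≺ Lt 0 (m≤m+n 3 q))
      (step-⊀ Ls a (n≤1+n _)) (subst (λ y → ¬ s (1 + a) ≺ y) s-end≡t₀ (step-⊀ Ls (1 + a) ≤-refl))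
      (step-⊀ Lt 0 (<⇒≤ (m≤m+n 3 q))) (step-⊀ Lt 1 (m≤m+n 3 q)) ¬r)
    avoid

  glue-localLadder : ∀ {s t} → IsLocalLadder (3 + a) s → IsLocalLadder q t →
    s (2 + a) ≡ t 0 → s (1 + a) ≺ t 1 → IsLocalLadder (2 + a + q) (glue (2 + a) s t)
  glue-localLadder {a} {q} {s} {t} Ls Lt s-end≡t₀ s≺t₁ = record
    { step-⊀ = glue-window {R = λ x y → ¬ x ≺ y} {s} {t} (step-⊀ Ls) (step-⊀ Lt) s-end≡t₀
                 no-step-across
    ; skip-≺ = glue-window {R = _≺_} {s} {t} (skip-≺ Ls) (skip-≺ Lt) s-end≡t₀ skip-across
    }
    where
    no-step-across : ∀ k j → k < 2 + a → 1 + k ≡ suc (2 + a + j) → ¬ s k ≺ t (suc j)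
    no-step-across k j k<2+a 1+k≡ =
      contradiction (subst (_< 2 + a) (suc-injective 1+k≡) k<2+a) (m+n≮m (2 + a) j)
    skip-across : ∀ k j → k < 2 + a → 2 + k ≡ suc (2 + a + j) → s k ≺ t (suc j)
    skip-across k zero    _       2+k≡ = subst (λ i → s i ≺ t 1) (sym k≡1+a) s≺t₁
      where
      k≡1+a : k ≡ 1 + a
      k≡1+a = trans (suc-injective (suc-injective 2+k≡)) (cong suc (+-identityʳ a))
    skip-across k (suc j) k<2+a 2+k≡ =
      contradiction (subst (_< 2 + a) (suc-injective (suc-injective 2+k≡)) k<2+a)
        (λ 2+a+j<2+a → m+1+n≰m a (s≤s⁻¹ (s≤s⁻¹ 2+a+j<2+a)))

  ladderSeq-gluing : ∀ {x s t} → AvoidsP311 P →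
    IsLadderSeq (3 + a) s → IsLadderSeq (3 + q) t →
    IsMax x (image s (3 + a)) → IsMin x (image t (3 + q)) →
    IsLadder P (image s (3 + a) ∪ image t (3 + q))
  ladderSeq-gluing {a} {q} {x} {s} {t} avoid Ls Lt x-max x-min =
    subst (IsLadder P) (image-glue {a = 2 + a} {q = 2 + q} s-end≡t₀)
      (localLadder⇒isLadder (≤-trans (m≤m+n 3 q) (m≤n+m (3 + q) (2 + a)))
        (glue-localLadder Ls′ Lt′ s-end≡t₀ (junction-≺ avoid Ls′ Lt′ s-end≡t₀)))
    where
    Ls′ : IsLocalLadder (3 + a) s
    Ls′ = ladderSeq⇒localLadder Ls
    Lt′ : IsLocalLadder (3 + q) t
    Lt′ = ladderSeq⇒localLadder Lt
    s-end≡t₀ : s (2 + a) ≡ t 0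
    s-end≡t₀ = trans (isMax-unique (ascending⇒isMax (localLadder⇒ascending (m≤m+n 3 a) Ls′)) x-max)
                     (isMin-unique x-min (ascending⇒isMin (localLadder⇒ascending (m≤m+n 3 q) Lt′) z<s))

  isLadder-∥-atMostTwo : ∀ {A x y₁ y₂ y₃} → IsLadder P A →
    x ∈ A → y₁ ∈ A → y₂ ∈ A → y₃ ∈ A → x ∥ y₁ → x ∥ y₂ → x ∥ y₃ →
    y₁ ≢ y₂ → y₁ ≢ y₃ → y₂ ≢ y₃ → Empty
  isLadder-∥-atMostTwo (_ , f , _ , _ , onto , f-rel)
    x∈ y₁∈ y₂∈ y₃∈ x∥y₁ x∥y₂ x∥y₃ y₁≢y₂ y₁≢y₃ y₂≢y₃
    with onto _ x∈ | onto _ y₁∈ | onto _ y₂∈ | onto _ y₃∈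
  ... | i , refl | _ , refl | _ , refl | _ , refl =
    adjacent-pigeonhole (adjacent x∥y₁) (adjacent x∥y₂) (adjacent x∥y₃)
      (index-≢ y₁≢y₂) (index-≢ y₁≢y₃) (index-≢ y₂≢y₃)
    where
    index-≢ : ∀ {j k} → f j ≢ f k → toℕ j ≢ toℕ k
    index-≢ fj≢fk e = fj≢fk (cong f (Fin.toℕ-injective e))
    adjacent : ∀ {j} → f i ∥ f j → Adjacent (toℕ i) (toℕ j)
    adjacent {j} (fi≢fj , fi⊀fj , fj⊀fi) = k+2≰l⇒adjacent (index-≢ fi≢fj)
      (fi⊀fj ∘ Equivalence.from (f-rel i j)) (fj⊀fi ∘ Equivalence.from (f-rel j i))

  avoids⇒gluing : AvoidsP311 P → LadderGluing P
  avoids⇒gluing avoid L L′ x LL LL′ _ x-max x-min 3≤∣L∣ 3≤∣L′∣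
    with isLadder⇒ladderSeq LL (proj₁ x-max) | isLadder⇒ladderSeq LL′ (proj₁ x-min)
  ... | m , s , refl , Ls | q , t , refl , Lt
    with ≤-trans 3≤∣L∣ (∣image∣≤ s m) | ≤-trans 3≤∣L′∣ (∣image∣≤ t q)
  ... | s≤s (s≤s (s≤s _)) | s≤s (s≤s (s≤s _)) = ladderSeq-gluing avoid Ls Lt x-max x-min

  gluing⇒avoids : LadderGluing P → AvoidsP311 P
  gluing⇒avoids gluing (g , g-injective , g-iso) =
    isLadder-∥-atMostTwo union (∈L 1 (s≤s (s≤s z≤n))) (∈L 0 z<s) (∈L 2 ≤-refl) ∈L′₁
      (incomparable 1F 0F (λ ()) (λ ()) (λ ())) (incomparable 1F 2F (λ ()) (λ ()) (λ ()))
      (incomparable 1F 3F (λ ()) (λ ()) (λ ()))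
      (distinct 0F 2F (λ ())) (distinct 0F 3F (λ ())) (distinct 2F 3F (λ ()))
    where
    related : ∀ {i j} → P311 i j → g i ≺ g j
    related = Equivalence.from (g-iso _ _)
    unrelated : ∀ {i j} → ¬ P311 i j → ¬ g i ≺ g j
    unrelated ¬c r = ¬c (Equivalence.to (g-iso _ _) r)
    distinct : ∀ i j → i ≢ j → g i ≢ g j
    distinct i j i≢j e = i≢j (g-injective e)
    incomparable : ∀ i j → i ≢ j → ¬ P311 i j → ¬ P311 j i → g i ∥ g j
    incomparable i j i≢j ¬cij ¬cji = distinct i j i≢j , unrelated ¬cij , unrelated ¬cji
    w w′ : ℕ → Fin n
    w k = g (clamp k)
    w′ k = w (2 + k)
    left : IsLocalLadder 3 w
    left = record
      { step-⊀ = λ { 0 _ → unrelated (λ ()) ; 1 _ → unrelated (λ ())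
                   ; (suc (suc _)) (s≤s (s≤s (s≤s ()))) }
      ; skip-≺ = λ { 0 _ → related r13 ; (suc _) (s≤s (s≤s (s≤s ()))) }
      }
    right : IsLocalLadder 3 w′
    right = record
      { step-⊀ = λ { 0 _ → unrelated (λ ()) ; 1 _ → unrelated (λ ())
                   ; (suc (suc _)) (s≤s (s≤s (s≤s ()))) }
      ; skip-≺ = λ { 0 _ → related r35 ; (suc _) (s≤s (s≤s (s≤s ()))) }
      }
    x-max : IsMax (w 2) (image w 3)
    x-max = ascending⇒isMax (localLadder⇒ascending ≤-refl left)
    x-min : IsMin (w 2) (image w′ 3)
    x-min = ascending⇒isMin (localLadder⇒ascending ≤-refl right) z<s
    union : IsLadder P (image w 3 ∪ image w′ 3)
    union = gluing (image w 3) (image w′ 3) (w 2)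
      (localLadder⇒isLadder ≤-refl left) (localLadder⇒isLadder ≤-refl right)
      (isMax∧isMin⇒∩≡⁅⁆ x-max x-min) x-max x-min
      (ascending⇒≤∣image∣ (localLadder⇒ascending ≤-refl left))
      (ascending⇒≤∣image∣ (localLadder⇒ascending ≤-refl right))
    ∈L : ∀ k → k < 3 → w k ∈ image w 3 ∪ image w′ 3
    ∈L k k<3 = x∈p∪q⁺ (inj₁ (∈-image⁺ {s = w} k<3))
    ∈L′₁ : w′ 1 ∈ image w 3 ∪ image w′ 3
    ∈L′₁ = x∈p∪q⁺ (inj₂ (∈-image⁺ {k = 1} {m = 3} {s = w′} (s≤s (s≤s z≤n))))

lemma3p11 : (n : ℕ) (P : NUIO n) → AvoidsP311 P ⇔ LadderGluing P
lemma3p11 n P = mk⇔ (avoids⇒gluing P) (gluing⇒avoids P)
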